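{- Let $1\le m\le R$ with $R\equiv m\pmod 2$ and $n\ge m+R$. Choose an $m$-card initial state on $n$ cards uniformly at random and play War with random putback. The probability that the game ends with Alice losing after exactly $R$ rounds (so the game is single-use and $R$-round) is $$\frac{C\!\left(\frac{R+m}{2}-1,\ \frac{R-m}{2}\right)}{2^R}.$$
   Context: War with $n$ cards labelled $1,\dots,n$ split between Alice and Bob; an $m$-card state is one where Alice holds $m$ cards (there are $n!$ such states, ordered hands). In a round both players reveal the top card and the owner of the higher card places both cards at the bottom of their hand, in an order chosen uniformly at random (random putback). A player with no cards loses. Single-use: Alice loses before Bob plays any card he won. $C(p,q)$ denotes the Catalan triangle entry: the number of strings of $p$ letters $U$ and $q$ letters $D$ in which every initial substring has at least as many $U$'s as $D$'s, $C(p,q)=\binom{p+q}{q}-\binom{p+q}{q-1}$. -}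

module Defs where

open import Data.Nat using (ℕ; zero; suc; _+_; _*_; _∸_; _^_; _<ᵇ_; NonZero)
open import Data.Nat.Properties using (_!≢0; m*n≢0; m^n≢0)
open import Data.Nat.Combinatorics using (_C_)
open import Data.Nat.Base using (_!)
open import Data.Bool using (Bool; true; false; if_then_else_)
open import Data.List using (List; []; _∷_; _++_; map; concatMap; upTo; take; drop; length)
open import Data.Nat.ListAction using (sum)
open import Data.Integer using (+_)
open import Data.Rational using (ℚ; _/_)

-- Catalan triangle entry C(p,q) = binom(p+q,q) - binom(p+q,q-1)  (binom(_, -1) = 0)
catalanTri : ℕ → ℕ → ℕ
catalanTri p zero    = (p + 0) C 0
catalanTri p (suc q) = ((p + suc q) C suc q) ∸ ((p + suc q) C q)

insertAll : ℕ → List ℕ → List (List ℕ)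
insertAll x []       = (x ∷ []) ∷ []
insertAll x (y ∷ ys) = (x ∷ y ∷ ys) ∷ map (y ∷_) (insertAll x ys)

perms : List ℕ → List (List ℕ)
perms []       = [] ∷ []
perms (x ∷ xs) = concatMap (insertAll x) (perms xs)

cards : ℕ → List ℕ
cards n = map suc (upTo n)

-- all bit strings of length k (one uniform random bit per round)
bitStrings : ℕ → List (List Bool)
bitStrings zero    = [] ∷ []
bitStrings (suc k) = concatMap (λ bs → (true ∷ bs) ∷ (false ∷ bs) ∷ []) (bitStrings k)

putback : Bool → ℕ → ℕ → List ℕ
putback true  x y = x ∷ y ∷ []
putback false x y = y ∷ x ∷ []

data Outcome : Set where
  aliceLosesAfter : ℕ → Outcome
  bobLosesAfter   : ℕ → Outcome
  unfinished      : Outcome       -- random bits exhausted, game not over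

shift : Outcome → Outcome
shift (aliceLosesAfter k) = aliceLosesAfter (suc k)
shift (bobLosesAfter k)   = bobLosesAfter (suc k)
shift unfinished          = unfinished

-- play War from Alice's hand and Bob's hand (top card first), with the
-- given sequence of putback-order bits (one bit consumed per round)
play : List ℕ → List ℕ → List Bool → Outcome
play []      b       bits       = aliceLosesAfter 0
play (x ∷ a) []      bits       = bobLosesAfter 0
play (x ∷ a) (y ∷ b) []         = unfinished
play (x ∷ a) (y ∷ b) (c ∷ bits) =
  shift (if y <ᵇ x then play (a ++ putback c x y) b bits
                   else play a (b ++ putback c x y) bits)

isAliceLossAfter : ℕ → Outcome → Bool
isAliceLossAfter R (aliceLosesAfter k) = k Data.Nat.≡ᵇ R
isAliceLossAfter R (bobLosesAfter k)   = false
isAliceLossAfter R unfinished          = false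

countTrue : {A : Set} → (A → Bool) → List A → ℕ
countTrue p []       = 0
countTrue p (x ∷ xs) = if p x then suc (countTrue p xs) else countTrue p xs

-- An m-card initial state is an ordering
-- π of the cards 1..n; Alice's hand is the first m cards, Bob's the rest.
favourable : (n m R : ℕ) → ℕ
favourable n m R =
  sum (map (λ π → countTrue (λ bits → isAliceLossAfter R (play (take m π) (drop m π) bits))
                             (bitStrings R))
            (perms (cards n)))

-- probability, for a uniformly random m-card state on n cards (n! states) and
-- R independent uniform putback bits (2^R strings), that Alice loses after exactly R rounds
probAliceLosesAfter : (n m R : ℕ) → ℚ
probAliceLosesAfter n m R =
  _/_ (+ favourable n m R) (n ! * 2 ^ R) {{m*n≢0 (n !) (2 ^ R) {{n !≢0}} {{m^n≢0 2 R}}}}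

_/2^_ : ℕ → ℕ → ℚ
k /2^ R = _/_ (+ k) (2 ^ R) {{m^n≢0 2 R}}

module Submission where

-- Alice wins the first round of an arrangement exactly when she loses it in the
-- arrangement with the two top cards exchanged, and the two putback orders of the
-- pair yield the hands read off from the arrangement and from the exchanged one.
-- Summed over all arrangements, each round therefore acts as a fair coin that moves
-- one card from loser to winner, so the count is n! times the number of paths of
-- Alice's hand size that move by ±1 and first reach 0 at round R; Bob, holding at
-- least R cards, cannot run out first.  The ballot theorem counts these paths by
-- the Catalan triangle entry.


module Fraction where
  open import Data.Nat as ℕ using (suc; NonZero)
  open import Data.Integer using (+_)
  open import Data.Integer.Properties using (pos-*)
  open import Data.Rational using (_/_)
  open import Data.Rational.Properties using (fromℚᵘ-cong)
  open import Data.Rational.Unnormalised using (mkℚᵘ; *≡*)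
  open import Relation.Binary.PropositionalEquality

  cross-mul⇒/≡/ : ∀ a b c d .{{_ : NonZero c}} .{{_ : NonZero d}} →
                  a ℕ.* d ≡ b ℕ.* c → (+ a) / c ≡ (+ b) / d
  cross-mul⇒/≡/ a b (suc c) (suc d) eq = fromℚᵘ-cong {mkℚᵘ (+ a) c} {mkℚᵘ (+ b) d}
    (*≡* (trans (sym (pos-* a (suc d))) (trans (cong +_ eq) (pos-* b (suc c)))))


module FirstPassage where
  open import Data.Nat
  open import Data.Nat.Properties
  open import Data.Nat.DivMod using (m≡m%n+[m/n]*n; m*n/n≡m)
  open import Data.Nat.Combinatorics using (_C_; nCk+nC[k+1]≡[n+1]C[k+1]; nCk≡nC[n∸k])
  open import Data.Product using (∃; _,_)
  open import Algebra.Properties.CommutativeSemigroup +-commutativeSemigroup using (interchange)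
  open import Relation.Binary.PropositionalEquality
  open ≡-Reasoning
  open import Defs using (catalanTri)

  firstPassages : ℕ → ℕ → ℕ
  firstPassages zero    zero    = 1
  firstPassages zero    (suc k) = 0
  firstPassages (suc a) zero    = 0
  firstPassages (suc a) (suc k) = firstPassages (suc (suc a)) k + firstPassages a k

  firstPassages-< : ∀ a k → k < a → firstPassages a k ≡ 0
  firstPassages-< (suc a) zero    _         = refl
  firstPassages-< (suc a) (suc k) (s≤s k<a) =
    cong₂ _+_ (firstPassages-< (suc (suc a)) k (m<n⇒m<1+n (m<n⇒m<1+n k<a)))
              (firstPassages-< a k k<a)

  firstPassages-diag : ∀ a → firstPassages a a ≡ 1
  firstPassages-diag zero    = refl
  firstPassages-diag (suc a) =
    cong₂ _+_ (firstPassages-< (suc (suc a)) a (m<n⇒m<1+n (n<1+n a))) (firstPassages-diag a)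

  prevBinomial : ℕ → ℕ → ℕ
  prevBinomial N zero    = 0
  prevBinomial N (suc q) = N C q

  pascal : ∀ N q → suc N C q ≡ prevBinomial N q + N C q
  pascal N zero    = refl
  pascal N (suc q) = sym (nCk+nC[k+1]≡[n+1]C[k+1] N q)

  central-symmetry : ∀ q → suc (q + q) C suc q ≡ suc (q + q) C q
  central-symmetry q = trans (nCk≡nC[n∸k] (s≤s (m≤n+m q q))) (cong (suc (q + q) C_) (m+n∸m≡n (suc q) q))

  -- The ballot theorem, with the subtraction moved to the left-hand side.
  firstPassages+prevBinomial : ∀ q j →
    firstPassages (suc j) (suc (j + q + q)) + prevBinomial (j + q + q) q ≡ (j + q + q) C q
  firstPassages+prevBinomial zero j = begin
    firstPassages (suc j) (suc (j + 0 + 0)) + 0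
      ≡⟨ +-identityʳ _ ⟩
    firstPassages (suc j) (suc (j + 0 + 0))
      ≡⟨ cong (λ x → firstPassages (suc j) (suc x)) (trans (+-identityʳ _) (+-identityʳ j)) ⟩
    firstPassages (suc j) (suc j)
      ≡⟨ firstPassages-diag (suc j) ⟩
    1 ∎
  firstPassages+prevBinomial (suc q) zero = begin
    firstPassages 1 (suc (suc q + suc q)) + prevBinomial (suc q + suc q) (suc q)
      ≡⟨ cong (λ x → firstPassages 1 (suc x) + prevBinomial x (suc q)) (cong suc (+-suc q q)) ⟩
    firstPassages 1 (suc (suc N)) + suc N C q
      ≡⟨ cong₂ _+_ (+-identityʳ _) (pascal N q) ⟩
    firstPassages 2 (suc N) + (prevBinomial N q + N C q)
      ≡⟨ sym (+-assoc (firstPassages 2 (suc N)) _ _) ⟩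
    (firstPassages 2 (suc N) + prevBinomial N q) + N C q
      ≡⟨ cong (_+ N C q) (firstPassages+prevBinomial q 1) ⟩
    N C q + N C q
      ≡⟨ cong (N C q +_) (sym (central-symmetry q)) ⟩
    N C q + N C suc q
      ≡⟨ nCk+nC[k+1]≡[n+1]C[k+1] N q ⟩
    suc N C suc q
      ≡⟨ cong (_C suc q) (cong suc (sym (+-suc q q))) ⟩
    (suc q + suc q) C suc q ∎
    where
    N : ℕ
    N = suc (q + q)
  firstPassages+prevBinomial (suc q) (suc j) = begin
    firstPassages (suc (suc j)) (suc N) + prevBinomial N (suc q)
      ≡⟨ cong (λ x → firstPassages (suc (suc j)) (suc x) + prevBinomial x (suc q)) N≡1+M ⟩
    (firstPassages (3 + j) (suc M) + firstPassages (suc j) (suc M)) + suc M C q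
      ≡⟨ cong (firstPassages (3 + j) (suc M) + firstPassages (suc j) (suc M) +_) (pascal M q) ⟩
    (firstPassages (3 + j) (suc M) + firstPassages (suc j) (suc M)) + (prevBinomial M q + M C q)
      ≡⟨ interchange (firstPassages (3 + j) (suc M)) _ _ _ ⟩
    (firstPassages (3 + j) (suc M) + prevBinomial M q) + (firstPassages (suc j) (suc M) + M C q)
      ≡⟨ cong₂ _+_ (firstPassages+prevBinomial q (2 + j))
                   (subst (λ x → firstPassages (suc j) (suc x) + prevBinomial x (suc q) ≡ x C suc q)
                          (+-suc-suc j q) (firstPassages+prevBinomial (suc q) j)) ⟩
    M C q + M C suc q
      ≡⟨ nCk+nC[k+1]≡[n+1]C[k+1] M q ⟩
    suc M C suc q
      ≡⟨ cong (_C suc q) (sym N≡1+M) ⟩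
    N C suc q ∎
    where
    N M : ℕ
    N = suc j + suc q + suc q
    M = 2 + j + q + q
    +-suc-suc : ∀ j q → j + suc q + suc q ≡ 2 + j + q + q
    +-suc-suc j q = trans (cong (_+ suc q) (+-suc j q)) (+-suc (suc (j + q)) q)
    N≡1+M : N ≡ suc M
    N≡1+M = cong suc (+-suc-suc j q)

  catalanTri≡firstPassages : ∀ j q → catalanTri (j + q) q ≡ firstPassages (suc j) (suc j + (q + q))
  catalanTri≡firstPassages j zero =
    sym (trans (cong (firstPassages (suc j)) (+-identityʳ (suc j))) (firstPassages-diag (suc j)))
  catalanTri≡firstPassages j (suc q) = begin
    N C suc q ∸ N C q
      ≡⟨ cong (_∸ N C q) (sym (firstPassages+prevBinomial (suc q) j)) ⟩
    (firstPassages (suc j) (suc N) + N C q) ∸ N C q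
      ≡⟨ m+n∸n≡m (firstPassages (suc j) (suc N)) (N C q) ⟩
    firstPassages (suc j) (suc N)
      ≡⟨ cong (λ x → firstPassages (suc j) (suc x)) (+-assoc j (suc q) (suc q)) ⟩
    firstPassages (suc j) (suc j + (suc q + suc q)) ∎
    where
    N : ℕ
    N = j + suc q + suc q

  +-self≡*2 : ∀ x → x + x ≡ x * 2
  +-self≡*2 x = trans (cong (x +_) (sym (+-identityʳ x))) (*-comm 2 x)

  +-self/2 : ∀ x → (x + x) / 2 ≡ x
  +-self/2 x = trans (cong (_/ 2) (+-self≡*2 x)) (m*n/n≡m x 2)

  even-gap : ∀ m R → m ≤ R → R % 2 ≡ m % 2 → ∃ λ q → R ≡ m + (q + q)
  even-gap m R m≤R eq = R / 2 ∸ m / 2 , (begin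
    R                               ≡⟨ R≡r+a*2 ⟩
    r + a * 2                       ≡⟨ cong (λ x → r + x * 2) (sym (m+[n∸m]≡n b≤a)) ⟩
    r + (b + (a ∸ b)) * 2           ≡⟨ cong (r +_) (*-distribʳ-+ 2 b (a ∸ b)) ⟩
    r + (b * 2 + (a ∸ b) * 2)       ≡⟨ sym (+-assoc r _ _) ⟩
    (r + b * 2) + (a ∸ b) * 2       ≡⟨ cong₂ _+_ (sym m≡r+b*2) (sym (+-self≡*2 (a ∸ b))) ⟩
    m + ((a ∸ b) + (a ∸ b))         ∎)
    where
    a b r : ℕ
    a = R / 2
    b = m / 2
    r = m % 2
    R≡r+a*2 : R ≡ r + a * 2
    R≡r+a*2 = trans (m≡m%n+[m/n]*n R 2) (cong (_+ a * 2) eq)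
    m≡r+b*2 : m ≡ r + b * 2
    m≡r+b*2 = m≡m%n+[m/n]*n m 2
    b≤a : b ≤ a
    b≤a = *-cancelʳ-≤ b a 2 (+-cancelˡ-≤ r _ _ (subst₂ _≤_ m≡r+b*2 R≡r+a*2 m≤R))

  catalanTri≡firstPassages-halves : ∀ m R → 1 ≤ m → m ≤ R → R % 2 ≡ m % 2 →
    catalanTri ((R + m) / 2 ∸ 1) ((R ∸ m) / 2) ≡ firstPassages m R
  catalanTri≡firstPassages-halves (suc j) R _ m≤R eq with even-gap (suc j) R m≤R eq
  ... | q , refl = trans (cong₂ catalanTri (cong (_∸ 1) sum/2) gap/2) (catalanTri≡firstPassages j q)
    where
    m : ℕ
    m = suc j
    sum/2 : (m + (q + q) + m) / 2 ≡ m + q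
    sum/2 = trans (cong (_/ 2) (begin
      m + (q + q) + m       ≡⟨ +-comm (m + (q + q)) m ⟩
      m + (m + (q + q))     ≡⟨ cong (m +_) (trans (sym (+-assoc m q q)) (+-comm (m + q) q)) ⟩
      m + (q + (m + q))     ≡⟨ sym (+-assoc m q (m + q)) ⟩
      (m + q) + (m + q)     ∎)) (+-self/2 (m + q))
    gap/2 : (m + (q + q) ∸ m) / 2 ≡ q
    gap/2 = trans (cong (_/ 2) (m+n∸m≡n m (q + q))) (+-self/2 q)


module InsertionPermutations where
  open import Data.Nat using (ℕ; suc; _+_; _*_; _≟_)
  open import Data.Nat.Base using (_!)
  open import Data.Nat.Properties using (*-comm)
  open import Data.List using (List; []; _∷_; _++_; map; concatMap; length)
  open import Data.List.Properties using (length-++; length-map; ∷-injectiveˡ; ∷-injectiveʳ)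
  open import Data.List.Membership.Propositional using (_∈_; _∉_)
  open import Data.List.Membership.Propositional.Properties
    using (∈-∃++; ∈-concatMap⁺; ∈-concatMap⁻; ∈-map⁺; ∈-map⁻)
  open import Data.List.Relation.Unary.Any using (Any; here; there)
  open import Data.List.Relation.Unary.All using (All; []; _∷_)
  import Data.List.Relation.Unary.All as All
  open import Data.List.Relation.Unary.AllPairs using ([]; _∷_)
  open import Data.List.Relation.Unary.Unique.Propositional using (Unique)
  open import Data.List.Relation.Unary.Unique.Propositional.Properties using (++⁺; map⁺)
  open import Data.List.Relation.Binary.Disjoint.Propositional using (Disjoint)
  open import Data.List.Relation.Binary.Permutation.Propositional using (_↭_; ↭-refl; ↭-sym; ↭-trans; prep; swap)
  open import Data.List.Relation.Binary.Permutation.Propositional.Properties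
    using (∈-resp-↭; ↭-empty-inv; drop-mid; ↭-length)
  open import Data.Product using (_,_)
  open import Data.Empty using (⊥)
  open import Relation.Nullary using (yes; no; contradiction)
  open import Relation.Binary.PropositionalEquality
  open import Defs using (insertAll; perms)

  ∈-insertAll⇒↭ : ∀ x σ {ys} → ys ∈ insertAll x σ → ys ↭ x ∷ σ
  ∈-insertAll⇒↭ x []      (here refl) = ↭-refl
  ∈-insertAll⇒↭ x (y ∷ σ) (here refl) = ↭-refl
  ∈-insertAll⇒↭ x (y ∷ σ) (there m) with ∈-map⁻ (y ∷_) m
  ... | zs , zs∈ , refl = ↭-trans (prep y (∈-insertAll⇒↭ x σ zs∈)) (swap y x ↭-refl)

  ∈-perms⇒↭ : ∀ xs {ys} → ys ∈ perms xs → ys ↭ xs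
  ∈-perms⇒↭ []       (here refl) = ↭-refl
  ∈-perms⇒↭ (x ∷ xs) m = go (perms xs) (λ σ∈ → ∈-perms⇒↭ xs σ∈) (∈-concatMap⁻ (insertAll x) {xs = perms xs} m)
    where
    go : ∀ {ys} L → (∀ {σ} → σ ∈ L → σ ↭ xs) → Any (λ σ → ys ∈ insertAll x σ) L → ys ↭ x ∷ xs
    go (σ ∷ L) L↭ (here p)  = ↭-trans (∈-insertAll⇒↭ x σ p) (prep x (L↭ (here refl)))
    go (σ ∷ L) L↭ (there p) = go L (λ τ∈ → L↭ (there τ∈)) p

  insert-∈-insertAll : ∀ x as bs → as ++ x ∷ bs ∈ insertAll x (as ++ bs)
  insert-∈-insertAll x []       []       = here refl
  insert-∈-insertAll x []       (b ∷ bs) = here refl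
  insert-∈-insertAll x (a ∷ as) bs       = there (∈-map⁺ (a ∷_) (insert-∈-insertAll x as bs))

  ↭⇒∈-perms : ∀ xs {ys} → ys ↭ xs → ys ∈ perms xs
  ↭⇒∈-perms [] p rewrite ↭-empty-inv p = here refl
  ↭⇒∈-perms (x ∷ xs) p with ∈-∃++ (∈-resp-↭ (↭-sym p) (here refl))
  ... | as , bs , refl = ∈-concatMap⁺ (insertAll x)
          (witness (↭⇒∈-perms xs (↭-sym (drop-mid [] as (↭-sym p)))) (insert-∈-insertAll x as bs))
    where
    witness : ∀ {L σ} → σ ∈ L → as ++ x ∷ bs ∈ insertAll x σ → Any (λ τ → as ++ x ∷ bs ∈ insertAll x τ) L
    witness (here refl) q = here q
    witness (there m)   q = there (witness m q)

  delete : ℕ → List ℕ → List ℕ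
  delete x []       = []
  delete x (y ∷ ys) with x ≟ y
  ... | yes _ = ys
  ... | no  _ = y ∷ delete x ys

  delete-head : ∀ x ys → delete x (x ∷ ys) ≡ ys
  delete-head x ys with x ≟ x
  ... | yes _   = refl
  ... | no  x≢x = contradiction refl x≢x

  delete-∷-≢ : ∀ {x y} ys → x ≢ y → delete x (y ∷ ys) ≡ y ∷ delete x ys
  delete-∷-≢ {x} {y} ys x≢y with x ≟ y
  ... | yes x≡y = contradiction x≡y x≢y
  ... | no  _   = refl

  delete-insertAll : ∀ x σ {ys} → x ∉ σ → ys ∈ insertAll x σ → delete x ys ≡ σ
  delete-insertAll x []      _   (here refl) = delete-head x []
  delete-insertAll x (y ∷ σ) _   (here refl) = delete-head x (y ∷ σ)
  delete-insertAll x (y ∷ σ) x∉ (there m) with ∈-map⁻ (y ∷_) m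
  ... | zs , zs∈ , refl = trans (delete-∷-≢ zs (λ x≡y → x∉ (here x≡y)))
                                (cong (y ∷_) (delete-insertAll x σ (λ x∈ → x∉ (there x∈)) zs∈))

  insertAll-unique : ∀ x σ → x ∉ σ → Unique (insertAll x σ)
  insertAll-unique x []      _  = [] ∷ []
  insertAll-unique x (y ∷ σ) x∉ =
    head-fresh (insertAll x σ) ∷ map⁺ ∷-injectiveʳ (insertAll-unique x σ (λ x∈ → x∉ (there x∈)))
    where
    head-fresh : ∀ L → All (λ w → x ∷ y ∷ σ ≢ w) (map (y ∷_) L)
    head-fresh []      = []
    head-fresh (w ∷ L) = (λ e → x∉ (here (∷-injectiveˡ e))) ∷ head-fresh L

  concatMap-insertAll-unique : ∀ x L → Unique L → (∀ {σ} → σ ∈ L → x ∉ σ) →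
                               Unique (concatMap (insertAll x) L)
  concatMap-insertAll-unique x []      _            _    = []
  concatMap-insertAll-unique x (σ ∷ L) (σ∉L ∷ uL) fresh =
    ++⁺ (insertAll-unique x σ (fresh (here refl)))
        (concatMap-insertAll-unique x L uL (λ τ∈ → fresh (there τ∈)))
        disjoint
    where
    disjoint : Disjoint (insertAll x σ) (concatMap (insertAll x) L)
    disjoint {v} (v∈σ , v∈L) = go L σ∉L (λ τ∈ → fresh (there τ∈)) (∈-concatMap⁻ (insertAll x) {xs = L} v∈L)
      where
      go : ∀ L′ → All (σ ≢_) L′ → (∀ {τ} → τ ∈ L′ → x ∉ τ) → Any (λ τ → v ∈ insertAll x τ) L′ → ⊥
      go (τ ∷ L′) (σ≢τ ∷ _) fresh′ (here v∈τ) =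
        σ≢τ (trans (sym (delete-insertAll x σ (fresh (here refl)) v∈σ))
                   (delete-insertAll x τ (fresh′ (here refl)) v∈τ))
      go (τ ∷ L′) (_ ∷ σ∉) fresh′ (there p) = go L′ σ∉ (λ τ∈ → fresh′ (there τ∈)) p

  perms-unique : ∀ xs → Unique xs → Unique (perms xs)
  perms-unique []       _            = [] ∷ []
  perms-unique (x ∷ xs) (x∉xs ∷ uxs) =
    concatMap-insertAll-unique x (perms xs) (perms-unique xs uxs)
      (λ σ∈ x∈σ → All.lookup x∉xs (∈-resp-↭ (∈-perms⇒↭ xs σ∈) x∈σ) refl)

  length-insertAll : ∀ x σ → length (insertAll x σ) ≡ suc (length σ)
  length-insertAll x []      = refl
  length-insertAll x (y ∷ σ) = cong suc (trans (length-map (y ∷_) (insertAll x σ)) (length-insertAll x σ))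

  length-concatMap-insertAll : ∀ x L c → (∀ {σ} → σ ∈ L → length (insertAll x σ) ≡ c) →
                               length (concatMap (insertAll x) L) ≡ length L * c
  length-concatMap-insertAll x []      c _   = refl
  length-concatMap-insertAll x (σ ∷ L) c len =
    trans (length-++ (insertAll x σ))
          (cong₂ _+_ (len (here refl)) (length-concatMap-insertAll x L c (λ τ∈ → len (there τ∈))))

  length-perms : ∀ xs → length (perms xs) ≡ length xs !
  length-perms []       = refl
  length-perms (x ∷ xs) = begin
    length (concatMap (insertAll x) (perms xs))
      ≡⟨ length-concatMap-insertAll x (perms xs) (suc (length xs))
           (λ {σ} σ∈ → trans (length-insertAll x σ) (cong suc (↭-length (∈-perms⇒↭ xs σ∈)))) ⟩
    length (perms xs) * suc (length xs)
      ≡⟨ cong (_* suc (length xs)) (length-perms xs) ⟩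
    length xs ! * suc (length xs)
      ≡⟨ *-comm (length xs !) (suc (length xs)) ⟩
    suc (length xs) * length xs ! ∎
    where open ≡-Reasoning


module PositionSwap where
  open import Data.Nat using (ℕ; zero; suc; _+_; _≟_; _<_; z≤n; s≤s)
  open import Data.Nat.Properties using (+-identityʳ; +-suc; suc-injective)
  open import Data.List using (List; []; _∷_; map; length)
  open import Data.List.Properties using (length-map)
  open import Data.List.Membership.Propositional using (_∈_)
  open import Data.List.Membership.Propositional.Properties using (∈-map⁺; ∈-map⁻)
  open import Data.List.Membership.Propositional.Properties.WithK using (unique∧set⇒bag)
  open import Data.List.Relation.Binary.BagAndSetEquality using (∼bag⇒↭)
  open import Data.List.Relation.Unary.Any using (here; there)
  open import Data.List.Relation.Unary.All using (All; []; _∷_)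
  import Data.List.Relation.Unary.All as All
  open import Data.List.Relation.Unary.AllPairs using ([]; _∷_)
  open import Data.List.Relation.Unary.Unique.Propositional using (Unique)
  open import Data.List.Relation.Binary.Permutation.Propositional using (_↭_; ↭-sym; ↭-trans; ↭⇒↭ₛ)
  open import Data.List.Relation.Binary.Permutation.Propositional.Properties using (↭-length)
  import Data.List.Relation.Binary.Permutation.Setoid.Properties as Setoid↭
  open import Data.Product using (Σ; _×_; _,_)
  open import Function.Bundles using (mk⇔)
  open import Relation.Nullary using (yes; no; contradiction)
  open import Relation.Binary.PropositionalEquality
  open import Defs using (perms)
  open InsertionPermutations using (∈-perms⇒↭; ↭⇒∈-perms; perms-unique)

  -- the default 0 beyond the end is never read: all indices used are in range
  at : List ℕ → ℕ → ℕ
  at []       _       = 0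
  at (x ∷ xs) zero    = x
  at (x ∷ xs) (suc i) = at xs i

  range : ℕ → ℕ → List ℕ
  range s zero    = []
  range s (suc L) = s ∷ range (suc s) L

  length-range : ∀ s L → length (range s L) ≡ L
  length-range s zero    = refl
  length-range s (suc L) = cong suc (length-range (suc s) L)

  at-map-range : ∀ (f : ℕ → ℕ) s L i → i < L → at (map f (range s L)) i ≡ f (s + i)
  at-map-range f s (suc L) zero    _         = cong f (sym (+-identityʳ s))
  at-map-range f s (suc L) (suc i) (s≤s i<L) = trans (at-map-range f (suc s) L i i<L) (cong f (sym (+-suc s i)))

  at-∈ : ∀ π i → i < length π → at π i ∈ π
  at-∈ (x ∷ π) zero    _         = here refl
  at-∈ (x ∷ π) (suc i) (s≤s i<n) = there (at-∈ π i i<n)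

  ∈⇒at : ∀ {z} π → z ∈ π → Σ ℕ (λ i → i < length π × at π i ≡ z)
  ∈⇒at (x ∷ π) (here refl) = zero , s≤s z≤n , refl
  ∈⇒at (x ∷ π) (there z∈) with ∈⇒at π z∈
  ... | i , i<n , eq = suc i , s≤s i<n , eq

  at-injective : ∀ π → Unique π → ∀ i j → i < length π → j < length π → at π i ≡ at π j → i ≡ j
  at-injective (x ∷ π) u        zero    zero    _         _         _  = refl
  at-injective (x ∷ π) (x∉ ∷ u) zero    (suc j) _         (s≤s j<n) eq = contradiction eq (All.lookup x∉ (at-∈ π j j<n))
  at-injective (x ∷ π) (x∉ ∷ u) (suc i) zero    (s≤s i<n) _         eq = contradiction (sym eq) (All.lookup x∉ (at-∈ π i i<n))
  at-injective (x ∷ π) (x∉ ∷ u) (suc i) (suc j) (s≤s i<n) (s≤s j<n) eq = cong suc (at-injective π u i j i<n j<n eq)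

  at-injective⇒unique : ∀ π → (∀ i j → i < length π → j < length π → at π i ≡ at π j → i ≡ j) → Unique π
  at-injective⇒unique []      _   = []
  at-injective⇒unique (x ∷ π) inj =
    All.tabulate fresh ∷ at-injective⇒unique π (λ i j i<n j<n eq → suc-injective (inj (suc i) (suc j) (s≤s i<n) (s≤s j<n) eq))
    where
    fresh : ∀ {w} → w ∈ π → x ≢ w
    fresh w∈ x≡w with ∈⇒at π w∈
    ... | i , i<n , eq with inj zero (suc i) (s≤s z≤n) (s≤s i<n) (trans x≡w (sym eq))
    ... | ()

  at-ext : ∀ xs ys → length xs ≡ length ys → (∀ i → i < length xs → at xs i ≡ at ys i) → xs ≡ ys
  at-ext []       []       _   _  = refl
  at-ext (x ∷ xs) (y ∷ ys) len eq =
    cong₂ _∷_ (eq zero (s≤s z≤n)) (at-ext xs ys (suc-injective len) (λ i i<n → eq (suc i) (s≤s i<n)))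

  transpose : ℕ → ℕ → ℕ → ℕ
  transpose p q i with i ≟ p | i ≟ q
  ... | yes _ | _     = q
  ... | no  _ | yes _ = p
  ... | no  _ | no  _ = i

  transpose-left : ∀ p q → transpose p q p ≡ q
  transpose-left p q with p ≟ p | p ≟ q
  ... | yes _   | _ = refl
  ... | no  p≢p | _ = contradiction refl p≢p

  transpose-right : ∀ p q → transpose p q q ≡ p
  transpose-right p q with q ≟ p | q ≟ q
  ... | yes q≡p | _       = q≡p
  ... | no  _   | yes _   = refl
  ... | no  _   | no  q≢q = contradiction refl q≢q

  transpose-other : ∀ p q i → i ≢ p → i ≢ q → transpose p q i ≡ i
  transpose-other p q i i≢p i≢q with i ≟ p | i ≟ q
  ... | yes i≡p | _       = contradiction i≡p i≢p
  ... | no  _   | yes i≡q = contradiction i≡q i≢q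
  ... | no  _   | no  _   = refl

  transpose-involutive : ∀ p q i → transpose p q (transpose p q i) ≡ i
  transpose-involutive p q i with i ≟ p | i ≟ q
  ... | yes refl | _        = transpose-right i q
  ... | no  _    | yes refl = transpose-left p i
  ... | no  i≢p  | no  i≢q  = transpose-other p q i i≢p i≢q

  transpose-< : ∀ p q i {L} → p < L → q < L → i < L → transpose p q i < L
  transpose-< p q i p<L q<L i<L with i ≟ p | i ≟ q
  ... | yes _ | _     = q<L
  ... | no  _ | yes _ = p<L
  ... | no  _ | no  _ = i<L

  swapAt : ℕ → ℕ → List ℕ → List ℕ
  swapAt p q π = map (λ i → at π (transpose p q i)) (range 0 (length π))

  length-swapAt : ∀ p q π → length (swapAt p q π) ≡ length π
  length-swapAt p q π = trans (length-map _ (range 0 (length π))) (length-range 0 (length π))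

  at-swapAt : ∀ p q π i → i < length π → at (swapAt p q π) i ≡ at π (transpose p q i)
  at-swapAt p q π i i<n = at-map-range _ 0 (length π) i i<n

  module _ (p q : ℕ) (π : List ℕ) (p<n : p < length π) (q<n : q < length π) where

    private
      transpose-<-length : ∀ {i} → i < length π → transpose p q i < length π
      transpose-<-length {i} = transpose-< p q i p<n q<n

      <-length-swapAt : ∀ {i} → i < length π → i < length (swapAt p q π)
      <-length-swapAt = subst (_ <_) (sym (length-swapAt p q π))

    swapAt-involutive : swapAt p q (swapAt p q π) ≡ π
    swapAt-involutive = at-ext _ _ (trans (length-swapAt p q (swapAt p q π)) (length-swapAt p q π)) entry
      where
      entry : ∀ i → i < length (swapAt p q (swapAt p q π)) → at (swapAt p q (swapAt p q π)) i ≡ at π i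
      entry i i<n′ = begin
        at (swapAt p q (swapAt p q π)) i       ≡⟨ at-swapAt p q (swapAt p q π) i (<-length-swapAt i<n) ⟩
        at (swapAt p q π) (transpose p q i)    ≡⟨ at-swapAt p q π (transpose p q i) (transpose-<-length i<n) ⟩
        at π (transpose p q (transpose p q i)) ≡⟨ cong (at π) (transpose-involutive p q i) ⟩
        at π i                                 ∎
        where
        open ≡-Reasoning
        i<n : i < length π
        i<n = subst (i <_) (trans (length-swapAt p q (swapAt p q π)) (length-swapAt p q π)) i<n′

    swapAt-unique : Unique π → Unique (swapAt p q π)
    swapAt-unique u = at-injective⇒unique (swapAt p q π) inj
      where
      inj : ∀ i j → i < length (swapAt p q π) → j < length (swapAt p q π) →
            at (swapAt p q π) i ≡ at (swapAt p q π) j → i ≡ j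
      inj i j i<n′ j<n′ eq =
        trans (sym (transpose-involutive p q i))
          (trans (cong (transpose p q)
                   (at-injective π u (transpose p q i) (transpose p q j) (transpose-<-length i<n) (transpose-<-length j<n)
                     (trans (sym (at-swapAt p q π i i<n)) (trans eq (at-swapAt p q π j j<n)))))
                 (transpose-involutive p q j))
        where
        i<n : i < length π
        i<n = subst (i <_) (length-swapAt p q π) i<n′
        j<n : j < length π
        j<n = subst (j <_) (length-swapAt p q π) j<n′

    swapAt-↭ : Unique π → swapAt p q π ↭ π
    swapAt-↭ u = ∼bag⇒↭ (unique∧set⇒bag (swapAt-unique u) u (mk⇔ to from))
      where
      to : ∀ {z} → z ∈ swapAt p q π → z ∈ π
      to z∈ with ∈⇒at (swapAt p q π) z∈
      ... | i , i<n′ , refl = subst (_∈ π) (sym (at-swapAt p q π i i<n)) (at-∈ π (transpose p q i) (transpose-<-length i<n))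
        where
        i<n : i < length π
        i<n = subst (i <_) (length-swapAt p q π) i<n′
      from : ∀ {z} → z ∈ π → z ∈ swapAt p q π
      from z∈ with ∈⇒at π z∈
      ... | j , j<n , refl =
        subst (_∈ swapAt p q π)
              (trans (at-swapAt p q π (transpose p q j) (transpose-<-length j<n)) (cong (at π) (transpose-involutive p q j)))
              (at-∈ (swapAt p q π) (transpose p q j) (<-length-swapAt (transpose-<-length j<n)))

  unique-resp-↭ : ∀ {xs ys : List ℕ} → Unique xs → xs ↭ ys → Unique ys
  unique-resp-↭ u xs↭ys = Setoid↭.Unique-resp-↭ (setoid ℕ) (↭⇒↭ₛ xs↭ys) u

  map-unique : ∀ (f : List ℕ → List ℕ) L → Unique L → (∀ {x y} → x ∈ L → y ∈ L → f x ≡ f y → x ≡ y) → Unique (map f L)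
  map-unique f []      _          _   = []
  map-unique f (x ∷ L) (x∉ ∷ u) inj =
    fresh L x∉ (λ y∈ → inj (here refl) (there y∈)) ∷ map-unique f L u (λ a∈ b∈ → inj (there a∈) (there b∈))
    where
    fresh : ∀ L′ → All (x ≢_) L′ → (∀ {y} → y ∈ L′ → f x ≡ f y → x ≡ y) → All (f x ≢_) (map f L′)
    fresh []       _          _    = []
    fresh (y ∷ L′) (x≢y ∷ x∉) inj′ = (λ eq → x≢y (inj′ (here refl) eq)) ∷ fresh L′ x∉ (λ z∈ → inj′ (there z∈))

  module _ (xs : List ℕ) (uxs : Unique xs) where

    ∈-perms⇒unique : ∀ {π} → π ∈ perms xs → Unique π
    ∈-perms⇒unique π∈ = unique-resp-↭ uxs (↭-sym (∈-perms⇒↭ xs π∈))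

    ∈-perms⇒length : ∀ {π} → π ∈ perms xs → length π ≡ length xs
    ∈-perms⇒length π∈ = ↭-length (∈-perms⇒↭ xs π∈)

    module _ (p q : ℕ) (p<n : p < length xs) (q<n : q < length xs) where

      private
        bounds : ∀ {π} → π ∈ perms xs → p < length π × q < length π
        bounds π∈ = subst (p <_) (sym (∈-perms⇒length π∈)) p<n , subst (q <_) (sym (∈-perms⇒length π∈)) q<n

        swapAt-involutive-perms : ∀ {π} → π ∈ perms xs → swapAt p q (swapAt p q π) ≡ π
        swapAt-involutive-perms π∈ with bounds π∈
        ... | p<π , q<π = swapAt-involutive p q _ p<π q<π

      swapAt-∈-perms : ∀ {π} → π ∈ perms xs → swapAt p q π ∈ perms xs
      swapAt-∈-perms π∈ with bounds π∈
      ... | p<π , q<π = ↭⇒∈-perms xs (↭-trans (swapAt-↭ p q _ p<π q<π (∈-perms⇒unique π∈)) (∈-perms⇒↭ xs π∈))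

      map-swapAt-perms-↭ : map (swapAt p q) (perms xs) ↭ perms xs
      map-swapAt-perms-↭ = ∼bag⇒↭ (unique∧set⇒bag (map-unique (swapAt p q) (perms xs) uperms inj) uperms (mk⇔ to from))
        where
        uperms : Unique (perms xs)
        uperms = perms-unique xs uxs
        inj : ∀ {x y} → x ∈ perms xs → y ∈ perms xs → swapAt p q x ≡ swapAt p q y → x ≡ y
        inj x∈ y∈ eq = trans (sym (swapAt-involutive-perms x∈)) (trans (cong (swapAt p q) eq) (swapAt-involutive-perms y∈))
        to : ∀ {z} → z ∈ map (swapAt p q) (perms xs) → z ∈ perms xs
        to z∈ with ∈-map⁻ (swapAt p q) z∈
        ... | π , π∈ , refl = swapAt-∈-perms π∈
        from : ∀ {z} → z ∈ perms xs → z ∈ map (swapAt p q) (perms xs)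
        from z∈ = subst (_∈ map (swapAt p q) (perms xs)) (swapAt-involutive-perms z∈) (∈-map⁺ (swapAt p q) (swapAt-∈-perms z∈))


module Rounds where
  open import Data.Nat using (ℕ; zero; suc; _+_; _≤_; s≤s; _<ᵇ_)
  open import Data.Nat.Properties using (m≤n⇒m≤1+n; +-assoc; +-commutativeSemigroup)
  open import Data.Bool using (Bool; true; false; if_then_else_)
  open import Data.List using (List; []; _∷_; _++_; concatMap)
  open import Algebra.Properties.CommutativeSemigroup +-commutativeSemigroup using (interchange)
  open import Relation.Binary.PropositionalEquality
  open import Defs
  open FirstPassage using (firstPassages)

  boolToℕ : Bool → ℕ
  boolToℕ true  = 1
  boolToℕ false = 0

  countTrue-∷ : ∀ {A : Set} (p : A → Bool) x xs → countTrue p (x ∷ xs) ≡ boolToℕ (p x) + countTrue p xs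
  countTrue-∷ p x xs with p x
  ... | true  = refl
  ... | false = refl

  countTrue-cong : ∀ {A : Set} {p q : A → Bool} → (∀ x → p x ≡ q x) → ∀ xs → countTrue p xs ≡ countTrue q xs
  countTrue-cong         p≡q []       = refl
  countTrue-cong {p = p} {q} p≡q (x ∷ xs) =
    trans (countTrue-∷ p x xs) (trans (cong₂ _+_ (cong boolToℕ (p≡q x)) (countTrue-cong p≡q xs)) (sym (countTrue-∷ q x xs)))

  countTrue-false : ∀ {A : Set} {p : A → Bool} → (∀ x → p x ≡ false) → ∀ xs → countTrue p xs ≡ 0
  countTrue-false         p≡false []       = refl
  countTrue-false {p = p} p≡false (x ∷ xs) =
    trans (countTrue-∷ p x xs) (cong₂ _+_ (cong boolToℕ (p≡false x)) (countTrue-false p≡false xs))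

  countTrue-bitStrings : ∀ (p : List Bool → Bool) k →
    countTrue p (bitStrings (suc k)) ≡ countTrue (λ bs → p (true ∷ bs)) (bitStrings k) + countTrue (λ bs → p (false ∷ bs)) (bitStrings k)
  countTrue-bitStrings p k = go (bitStrings k)
    where
    open ≡-Reasoning
    withFirstBit : List Bool → List (List Bool)
    withFirstBit bs = (true ∷ bs) ∷ (false ∷ bs) ∷ []
    pt pf : List Bool → Bool
    pt bs = p (true ∷ bs)
    pf bs = p (false ∷ bs)
    go : ∀ L → countTrue p (concatMap withFirstBit L) ≡ countTrue pt L + countTrue pf L
    go []      = refl
    go (x ∷ L) = begin
      countTrue p ((true ∷ x) ∷ (false ∷ x) ∷ concatMap withFirstBit L)
        ≡⟨ countTrue-∷ p (true ∷ x) ((false ∷ x) ∷ concatMap withFirstBit L) ⟩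
      boolToℕ (pt x) + countTrue p ((false ∷ x) ∷ concatMap withFirstBit L)
        ≡⟨ cong (boolToℕ (pt x) +_) (countTrue-∷ p (false ∷ x) (concatMap withFirstBit L)) ⟩
      boolToℕ (pt x) + (boolToℕ (pf x) + countTrue p (concatMap withFirstBit L))
        ≡⟨ cong (λ z → boolToℕ (pt x) + (boolToℕ (pf x) + z)) (go L) ⟩
      boolToℕ (pt x) + (boolToℕ (pf x) + (countTrue pt L + countTrue pf L))
        ≡⟨ sym (+-assoc (boolToℕ (pt x)) _ _) ⟩
      (boolToℕ (pt x) + boolToℕ (pf x)) + (countTrue pt L + countTrue pf L)
        ≡⟨ interchange (boolToℕ (pt x)) _ _ _ ⟩
      (boolToℕ (pt x) + countTrue pt L) + (boolToℕ (pf x) + countTrue pf L)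
        ≡⟨ sym (cong₂ _+_ (countTrue-∷ pt x L) (countTrue-∷ pf x L)) ⟩
      countTrue pt (x ∷ L) + countTrue pf (x ∷ L) ∎

  isAliceLossAfter-shift : ∀ k o → isAliceLossAfter (suc k) (shift o) ≡ isAliceLossAfter k o
  isAliceLossAfter-shift k (aliceLosesAfter j) = refl
  isAliceLossAfter-shift k (bobLosesAfter j)   = refl
  isAliceLossAfter-shift k unfinished          = refl

  lossCount : List ℕ → List ℕ → ℕ → ℕ
  lossCount A B k = countTrue (λ bits → isAliceLossAfter k (play A B bits)) (bitStrings k)

  -- Lattice paths of Alice's and Bob's hand sizes: each round moves one card
  -- from the loser to the winner, and Alice must empty first, at round k.
  lossPaths : ℕ → ℕ → ℕ → ℕ
  lossPaths zero    b       zero    = 1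
  lossPaths zero    b       (suc k) = 0
  lossPaths (suc a) zero    k       = 0
  lossPaths (suc a) (suc b) zero    = 0
  lossPaths (suc a) (suc b) (suc k) = lossPaths (suc (suc a)) b k + lossPaths a (suc (suc b)) k

  lossPaths≡firstPassages : ∀ a b k → k ≤ b → lossPaths a b k ≡ firstPassages a k
  lossPaths≡firstPassages zero    b       zero    _         = refl
  lossPaths≡firstPassages zero    b       (suc k) _         = refl
  lossPaths≡firstPassages (suc a) zero    zero    _         = refl
  lossPaths≡firstPassages (suc a) (suc b) zero    _         = refl
  lossPaths≡firstPassages (suc a) (suc b) (suc k) (s≤s k≤b) =
    cong₂ _+_ (lossPaths≡firstPassages (suc (suc a)) b k k≤b)
              (lossPaths≡firstPassages a (suc (suc b)) k (m≤n⇒m≤1+n (m≤n⇒m≤1+n k≤b)))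

  lossCount-[] : ∀ B b k → lossCount [] B k ≡ lossPaths 0 b k
  lossCount-[] B b zero    = refl
  lossCount-[] B b (suc k) = countTrue-false (λ _ → refl) (bitStrings (suc k))

  lossCount-∷-[] : ∀ x A a k → lossCount (x ∷ A) [] k ≡ lossPaths (suc a) 0 k
  lossCount-∷-[] x A a k = countTrue-false (λ _ → refl) (bitStrings k)

  lossCount-∷-∷ : ∀ x A y B k → lossCount (x ∷ A) (y ∷ B) (suc k) ≡
    (if y <ᵇ x then lossCount (A ++ x ∷ y ∷ []) B k + lossCount (A ++ y ∷ x ∷ []) B k
               else lossCount A (B ++ x ∷ y ∷ []) k + lossCount A (B ++ y ∷ x ∷ []) k)
  lossCount-∷-∷ x A y B k =
    trans (countTrue-bitStrings (λ bits → isAliceLossAfter (suc k) (play (x ∷ A) (y ∷ B) bits)) k) (by-winner (y <ᵇ x) refl)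
    where
    after-round : ∀ c → (y <ᵇ x) ≡ c → ∀ b bs →
      isAliceLossAfter (suc k) (play (x ∷ A) (y ∷ B) (b ∷ bs))
        ≡ isAliceLossAfter k (if c then play (A ++ putback b x y) B bs else play A (B ++ putback b x y) bs)
    after-round c refl b bs =
      isAliceLossAfter-shift k (if y <ᵇ x then play (A ++ putback b x y) B bs else play A (B ++ putback b x y) bs)
    by-winner : ∀ c → (y <ᵇ x) ≡ c →
      countTrue (λ bs → isAliceLossAfter (suc k) (play (x ∷ A) (y ∷ B) (true ∷ bs))) (bitStrings k)
        + countTrue (λ bs → isAliceLossAfter (suc k) (play (x ∷ A) (y ∷ B) (false ∷ bs))) (bitStrings k)
      ≡ (if c then lossCount (A ++ x ∷ y ∷ []) B k + lossCount (A ++ y ∷ x ∷ []) B k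
              else lossCount A (B ++ x ∷ y ∷ []) k + lossCount A (B ++ y ∷ x ∷ []) k)
    by-winner true  eq = cong₂ _+_ (countTrue-cong (after-round true eq true) (bitStrings k))
                                   (countTrue-cong (after-round true eq false) (bitStrings k))
    by-winner false eq = cong₂ _+_ (countTrue-cong (after-round false eq true) (bitStrings k))
                                   (countTrue-cong (after-round false eq false) (bitStrings k))


module Averaging where
  open import Data.Nat using (ℕ; zero; suc; _+_; _*_; _<_; _<ᵇ_)
  open import Data.Nat.Properties using (+-comm; *-distribˡ-+; +-commutativeSemigroup)
  open import Data.Nat.ListAction using (sum)
  open import Data.Nat.ListAction.Properties using (sum-↭)
  open import Data.Bool using (Bool; true; false; if_then_else_; not)
  open import Data.List using (List; []; _∷_; _++_; map; length)
  open import Data.List.Properties using (map-∘; map-++; length-++; ++-assoc)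
  open import Data.List.Membership.Propositional using (_∈_)
  open import Data.List.Relation.Unary.Any using (here; there)
  open import Data.List.Relation.Unary.All using (All; []; _∷_)
  import Data.List.Relation.Unary.All as All
  import Data.List.Relation.Unary.All.Properties as All
  open import Data.List.Relation.Unary.AllPairs using (_∷_)
  open import Data.List.Relation.Unary.Unique.Propositional using (Unique)
  open import Data.List.Relation.Binary.Permutation.Propositional using (_↭_; ↭-sym; ↭-trans; ↭-reflexive; prep)
  open import Data.List.Relation.Binary.Permutation.Propositional.Properties
    using (++⁺ˡ; ++-comm; All-resp-↭; shift) renaming (map⁺ to map⁺-↭)
  open import Data.Product using (_×_; _,_; proj₁; proj₂)
  open import Function using (_∘_)
  open import Relation.Nullary using (contradiction)
  open import Relation.Binary.PropositionalEquality
  open import Algebra.Properties.CommutativeSemigroup +-commutativeSemigroup using (interchange)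
  open import Defs using (perms)
  open PositionSwap
  open Rounds

  sumOver : {A : Set} → List A → (A → ℕ) → ℕ
  sumOver L f = sum (map f L)

  module _ {A : Set} where

    sumOver-cong : ∀ L {f g : A → ℕ} → (∀ {x} → x ∈ L → f x ≡ g x) → sumOver L f ≡ sumOver L g
    sumOver-cong []      f≡g = refl
    sumOver-cong (x ∷ L) f≡g = cong₂ _+_ (f≡g (here refl)) (sumOver-cong L (λ x∈ → f≡g (there x∈)))

    sumOver-+ : ∀ L (f g : A → ℕ) → sumOver L (λ x → f x + g x) ≡ sumOver L f + sumOver L g
    sumOver-+ []      f g = refl
    sumOver-+ (x ∷ L) f g = trans (cong (f x + g x +_) (sumOver-+ L f g)) (interchange (f x) (g x) _ _)

    sumOver-const : ∀ L c → sumOver {A} L (λ _ → c) ≡ length L * c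
    sumOver-const []      c = refl
    sumOver-const (x ∷ L) c = cong (c +_) (sumOver-const L c)

    sumOver-↭ : ∀ L (σ : A → A) → map σ L ↭ L → (f : A → ℕ) → sumOver L (f ∘ σ) ≡ sumOver L f
    sumOver-↭ L σ σL↭L f = trans (cong sum (map-∘ L)) (sum-↭ (map⁺-↭ f σL↭L))

    -- Reindexing the σ x halves by σ turns them into the complementary branch of the x halves.
    sumOver-pairing : ∀ L (σ : A → A) → map σ L ↭ L → (g : A → Bool) → (∀ {x} → x ∈ L → not (g (σ x)) ≡ g x) →
      (f h : A → ℕ) → sumOver L (λ x → if g x then f x + f (σ x) else h x + h (σ x)) ≡ sumOver L f + sumOver L h
    sumOver-pairing L σ σL↭L g flip f h = begin
      sumOver L (λ x → if g x then f x + f (σ x) else h x + h (σ x))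
        ≡⟨ sumOver-cong L (λ {x} _ → if-+ (g x) (f x) (f (σ x)) (h x) (h (σ x))) ⟩
      sumOver L (λ x → branch x + (if g x then f (σ x) else h (σ x)))
        ≡⟨ sumOver-+ L branch _ ⟩
      sumOver L branch + sumOver L (λ x → if g x then f (σ x) else h (σ x))
        ≡⟨ cong (sumOver L branch +_) (sumOver-cong L (λ {x} x∈ → cong (λ b → if b then f (σ x) else h (σ x)) (sym (flip x∈)))) ⟩
      sumOver L branch + sumOver L (branch′ ∘ σ)
        ≡⟨ cong (sumOver L branch +_) (sumOver-↭ L σ σL↭L branch′) ⟩
      sumOver L branch + sumOver L branch′
        ≡⟨ sym (sumOver-+ L branch branch′) ⟩
      sumOver L (λ x → branch x + branch′ x)
        ≡⟨ sumOver-cong L (λ {x} _ → if+if-not (g x) (f x) (h x)) ⟩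
      sumOver L (λ x → f x + h x)
        ≡⟨ sumOver-+ L f h ⟩
      sumOver L f + sumOver L h ∎
      where
      open ≡-Reasoning
      branch branch′ : A → ℕ
      branch  x = if g x then f x else h x
      branch′ x = if not (g x) then f x else h x
      if-+ : ∀ b u u′ v v′ → (if b then u + u′ else v + v′) ≡ (if b then u else v) + (if b then u′ else v′)
      if-+ true  _ _ _ _ = refl
      if-+ false _ _ _ _ = refl
      if+if-not : ∀ b u v → (if b then u else v) + (if not b then u else v) ≡ u + v
      if+if-not true  u v = refl
      if+if-not false u v = +-comm v u

  <ᵇ-flip : ∀ a b → a ≢ b → not (a <ᵇ b) ≡ (b <ᵇ a)
  <ᵇ-flip zero    zero    a≢b = contradiction refl a≢b
  <ᵇ-flip zero    (suc b) _   = refl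
  <ᵇ-flip (suc a) zero    _   = refl
  <ᵇ-flip (suc a) (suc b) a≢b = <ᵇ-flip a b (λ a≡b → a≢b (cong suc a≡b))

  pick : List ℕ → List ℕ → List ℕ
  pick π R = map (at π) R

  pick-swapAt : ∀ p q π R → All (_< length π) R → All (p ≢_) R → All (q ≢_) R → pick (swapAt p q π) R ≡ pick π R
  pick-swapAt p q π []      _           _           _           = refl
  pick-swapAt p q π (r ∷ R) (r<n ∷ R<n) (p≢r ∷ p∉R) (q≢r ∷ q∉R) = cong₂ _∷_
    (trans (at-swapAt p q π r r<n) (cong (at π) (transpose-other p q r (p≢r ∘ sym) (q≢r ∘ sym))))
    (pick-swapAt p q π R R<n p∉R q∉R)

  length-++-pair : ∀ (P : List ℕ) (p q : ℕ) → length (P ++ p ∷ q ∷ []) ≡ suc (suc (length P))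
  length-++-pair P p q = trans (length-++ P) (+-comm (length P) 2)

  Positions : ℕ → List ℕ → Set
  Positions n R = Unique R × All (_< n) R

  positions-↭ : ∀ {n R R′} → R ↭ R′ → Positions n R → Positions n R′
  positions-↭ R↭R′ (uR , R<n) = unique-resp-↭ uR R↭R′ , All-resp-↭ R↭R′ R<n

  module _ (xs : List ℕ) (uxs : Unique xs) where

    module FirstRound (k p q : ℕ) (P Q : List ℕ) (pos : Positions (length xs) (p ∷ q ∷ (P ++ Q))) where

      private
        Π : List (List ℕ)
        Π = perms xs
        p∉ : All (p ≢_) (q ∷ P ++ Q)
        p∉ with proj₁ pos
        ... | p∉ ∷ _ = p∉
        q∉ : All (q ≢_) (P ++ Q)
        q∉ with proj₁ pos
        ... | _ ∷ q∉ ∷ _ = q∉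
        p<n : p < length xs
        p<n = All.head (proj₂ pos)
        q<n : q < length xs
        q<n = All.head (All.tail (proj₂ pos))
        PQ<n : All (_< length xs) (P ++ Q)
        PQ<n = All.tail (All.tail (proj₂ pos))

      aliceWins : List ℕ → Bool
      aliceWins π = at π q <ᵇ at π p

      aliceWon bobWon : List ℕ → ℕ
      aliceWon π = lossCount (pick π (P ++ p ∷ q ∷ [])) (pick π Q) k
      bobWon   π = lossCount (pick π P) (pick π (Q ++ p ∷ q ∷ [])) k

      module _ {π : List ℕ} (π∈ : π ∈ perms xs) where

        private
          within : ∀ {i} → i < length xs → i < length π
          within = subst (_ <_) (sym (∈-perms⇒length xs uxs π∈))
          at-swapAt-p : at (swapAt p q π) p ≡ at π q
          at-swapAt-p = trans (at-swapAt p q π p (within p<n)) (cong (at π) (transpose-left p q))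
          at-swapAt-q : at (swapAt p q π) q ≡ at π p
          at-swapAt-q = trans (at-swapAt p q π q (within q<n)) (cong (at π) (transpose-right p q))
          pick-swapAt-avoiding : ∀ R → All (_< length xs) R → All (p ≢_) R → All (q ≢_) R → pick (swapAt p q π) R ≡ pick π R
          pick-swapAt-avoiding R R<n = pick-swapAt p q π R (All.map within R<n)
          pick-P : pick (swapAt p q π) P ≡ pick π P
          pick-P = pick-swapAt-avoiding P (proj₁ (All.++⁻ P PQ<n)) (proj₁ (All.++⁻ P (All.tail p∉))) (proj₁ (All.++⁻ P q∉))
          pick-Q : pick (swapAt p q π) Q ≡ pick π Q
          pick-Q = pick-swapAt-avoiding Q (proj₂ (All.++⁻ P PQ<n)) (proj₂ (All.++⁻ P (All.tail p∉))) (proj₂ (All.++⁻ P q∉))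
          pick-++-pair : ∀ π R → pick π (R ++ p ∷ q ∷ []) ≡ pick π R ++ at π p ∷ at π q ∷ []
          pick-++-pair π R = map-++ (at π) R (p ∷ q ∷ [])

        aliceWins-swapAt : not (aliceWins (swapAt p q π)) ≡ aliceWins π
        aliceWins-swapAt = trans (cong₂ (λ u v → not (u <ᵇ v)) at-swapAt-q at-swapAt-p) (<ᵇ-flip (at π p) (at π q) distinct)
          where
          distinct : at π p ≢ at π q
          distinct eq = All.head p∉ (at-injective π (∈-perms⇒unique xs uxs π∈) p q (within p<n) (within q<n) eq)

        lossCount-first-round :
          lossCount (pick π (p ∷ P)) (pick π (q ∷ Q)) (suc k)
            ≡ (if aliceWins π then aliceWon π + aliceWon (swapAt p q π) else bobWon π + bobWon (swapAt p q π))
        lossCount-first-round = trans (lossCount-∷-∷ (at π p) (pick π P) (at π q) (pick π Q) k)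
          (sym (cong₂ (λ u v → if aliceWins π then u else v)
                      (cong₂ _+_ aliceWon-π aliceWon-swapAt) (cong₂ _+_ bobWon-π bobWon-swapAt)))
          where
          swapped-pair : ∀ R → pick (swapAt p q π) R ≡ pick π R →
                         pick (swapAt p q π) (R ++ p ∷ q ∷ []) ≡ pick π R ++ at π q ∷ at π p ∷ []
          swapped-pair R pick-R = trans (pick-++-pair (swapAt p q π) R)
                                        (cong₂ _++_ pick-R (cong₂ (λ x y → x ∷ y ∷ []) at-swapAt-p at-swapAt-q))
          aliceWon-π : aliceWon π ≡ lossCount (pick π P ++ at π p ∷ at π q ∷ []) (pick π Q) k
          aliceWon-π = cong (λ A → lossCount A (pick π Q) k) (pick-++-pair π P)
          aliceWon-swapAt : aliceWon (swapAt p q π) ≡ lossCount (pick π P ++ at π q ∷ at π p ∷ []) (pick π Q) k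
          aliceWon-swapAt = cong₂ (λ A B → lossCount A B k) (swapped-pair P pick-P) pick-Q
          bobWon-π : bobWon π ≡ lossCount (pick π P) (pick π Q ++ at π p ∷ at π q ∷ []) k
          bobWon-π = cong (λ B → lossCount (pick π P) B k) (pick-++-pair π Q)
          bobWon-swapAt : bobWon (swapAt p q π) ≡ lossCount (pick π P) (pick π Q ++ at π q ∷ at π p ∷ []) k
          bobWon-swapAt = cong₂ (λ A B → lossCount A B k) pick-P (swapped-pair Q pick-Q)

      sumOver-first-round :
        sumOver Π (λ π → lossCount (pick π (p ∷ P)) (pick π (q ∷ Q)) (suc k)) ≡ sumOver Π aliceWon + sumOver Π bobWon
      sumOver-first-round =
        trans (sumOver-cong Π lossCount-first-round)
              (sumOver-pairing Π (swapAt p q) (map-swapAt-perms-↭ xs uxs p q p<n q<n) aliceWins aliceWins-swapAt aliceWon bobWon)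

    sumOver-lossCount : ∀ k P Q → Positions (length xs) (P ++ Q) →
      sumOver (perms xs) (λ π → lossCount (pick π P) (pick π Q) k) ≡ length (perms xs) * lossPaths (length P) (length Q) k
    sumOver-lossCount k [] Q _ =
      trans (sumOver-cong (perms xs) (λ {π} _ → lossCount-[] (pick π Q) (length Q) k)) (sumOver-const (perms xs) _)
    sumOver-lossCount k (p ∷ P) [] _ =
      trans (sumOver-cong (perms xs) (λ {π} _ → lossCount-∷-[] (at π p) (pick π P) (length P) k)) (sumOver-const (perms xs) _)
    sumOver-lossCount zero    (p ∷ P) (q ∷ Q) _   = sumOver-const (perms xs) 0
    sumOver-lossCount (suc k) (p ∷ P) (q ∷ Q) pos = begin
      sumOver Π (λ π → lossCount (pick π (p ∷ P)) (pick π (q ∷ Q)) (suc k))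
        ≡⟨ sumOver-first-round ⟩
      sumOver Π aliceWon + sumOver Π bobWon
        ≡⟨ cong₂ _+_ (sumOver-lossCount k (P ++ p ∷ q ∷ []) Q (positions-↭ (↭-sym alice-gathers) gathered))
                     (sumOver-lossCount k P (Q ++ p ∷ q ∷ []) (positions-↭ (↭-sym bob-gathers) gathered)) ⟩
      ∣Π∣ * lossPaths (length (P ++ p ∷ q ∷ [])) (length Q) k + ∣Π∣ * lossPaths (length P) (length (Q ++ p ∷ q ∷ [])) k
        ≡⟨ cong₂ (λ a b → ∣Π∣ * lossPaths a (length Q) k + ∣Π∣ * lossPaths (length P) b k)
                 (length-++-pair P p q) (length-++-pair Q p q) ⟩
      ∣Π∣ * lossPaths (suc (suc (length P))) (length Q) k + ∣Π∣ * lossPaths (length P) (suc (suc (length Q))) k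
        ≡⟨ sym (*-distribˡ-+ ∣Π∣ _ _) ⟩
      ∣Π∣ * lossPaths (suc (length P)) (suc (length Q)) (suc k) ∎
      where
      open ≡-Reasoning
      Π : List (List ℕ)
      Π = perms xs
      ∣Π∣ : ℕ
      ∣Π∣ = length Π
      pair-first : P ++ p ∷ q ∷ Q ↭ p ∷ q ∷ (P ++ Q)
      pair-first = ↭-trans (shift p P (q ∷ Q)) (prep p (shift q P Q))
      gathered : Positions (length xs) (p ∷ q ∷ (P ++ Q))
      gathered = positions-↭ (prep p (shift q P Q)) pos
      alice-gathers : (P ++ p ∷ q ∷ []) ++ Q ↭ p ∷ q ∷ (P ++ Q)
      alice-gathers = ↭-trans (↭-reflexive (++-assoc P (p ∷ q ∷ []) Q)) pair-first
      bob-gathers : P ++ (Q ++ p ∷ q ∷ []) ↭ p ∷ q ∷ (P ++ Q)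
      bob-gathers = ↭-trans (++⁺ˡ P (++-comm Q (p ∷ q ∷ []))) pair-first
      open FirstRound k p q P Q gathered


module Deal where
  open import Data.Nat using (ℕ; zero; suc; _+_; _*_; _∸_; _≤_; _<_; s≤s)
  open import Data.Nat.Properties using (+-identityʳ; +-suc; m+[n∸m]≡n; <⇒≢; ≤-refl; ≤-trans; n≤1+n; m≤m+n)
  open import Data.List using ([]; _∷_; _++_; take; drop; length)
  open import Data.List.Membership.Propositional using (_∈_)
  open import Data.List.Relation.Unary.All using (All; []; _∷_)
  import Data.List.Relation.Unary.All as All
  open import Data.List.Relation.Unary.AllPairs using ([]; _∷_)
  open import Data.List.Relation.Unary.Unique.Propositional using (Unique)
  open import Data.Product using (_×_; _,_; proj₂)
  open import Relation.Binary.PropositionalEquality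
  open import Defs using (perms)
  open PositionSwap using (at; range; length-range; ∈-perms⇒length)
  open Rounds using (lossCount; lossPaths)
  open Averaging

  pick-∷-range : ∀ x π s L → pick (x ∷ π) (range (suc s) L) ≡ pick π (range s L)
  pick-∷-range x π s zero    = refl
  pick-∷-range x π s (suc L) = cong (at π s ∷_) (pick-∷-range x π (suc s) L)

  take≡pick : ∀ m π → m ≤ length π → take m π ≡ pick π (range 0 m)
  take≡pick zero    π       _         = refl
  take≡pick (suc m) (x ∷ π) (s≤s m≤n) = cong (x ∷_) (trans (take≡pick m π m≤n) (sym (pick-∷-range x π 0 m)))

  ≡pick-range : ∀ π → π ≡ pick π (range 0 (length π))
  ≡pick-range []      = refl
  ≡pick-range (x ∷ π) = cong (x ∷_) (trans (≡pick-range π) (sym (pick-∷-range x π 0 (length π))))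

  drop≡pick : ∀ m π → m ≤ length π → drop m π ≡ pick π (range m (length π ∸ m))
  drop≡pick zero    π       _         = ≡pick-range π
  drop≡pick (suc m) (x ∷ π) (s≤s m≤n) = trans (drop≡pick m π m≤n) (sym (pick-∷-range x π m (length π ∸ m)))

  range-++ : ∀ s a b → range s (a + b) ≡ range s a ++ range (s + a) b
  range-++ s zero    b = cong (λ t → range t b) (sym (+-identityʳ s))
  range-++ s (suc a) b = cong (s ∷_) (trans (range-++ (suc s) a b) (cong (λ t → range (suc s) a ++ range t b) (sym (+-suc s a))))

  range-bounds : ∀ s L → All (λ r → s ≤ r × r < s + L) (range s L)
  range-bounds s zero    = []
  range-bounds s (suc L) = (≤-refl , subst (s <_) (sym (+-suc s L)) (s≤s (m≤m+n s L)))
    ∷ All.map (λ {r} (s<r , r<) → ≤-trans (n≤1+n s) s<r , subst (r <_) (sym (+-suc s L)) r<) (range-bounds (suc s) L)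

  range-unique : ∀ s L → Unique (range s L)
  range-unique s zero    = []
  range-unique s (suc L) = All.map (λ (s<r , _) → <⇒≢ s<r) (range-bounds (suc s) L) ∷ range-unique (suc s) L

  sumOver-lossCount-take-drop : ∀ xs → Unique xs → ∀ m k → m ≤ length xs →
    sumOver (perms xs) (λ π → lossCount (take m π) (drop m π) k) ≡ length (perms xs) * lossPaths m (length xs ∸ m) k
  sumOver-lossCount-take-drop xs uxs m k m≤n = begin
    sumOver (perms xs) (λ π → lossCount (take m π) (drop m π) k)
      ≡⟨ sumOver-cong (perms xs) (λ π∈ → cong₂ (λ A B → lossCount A B k) (take-pick π∈) (drop-pick π∈)) ⟩
    sumOver (perms xs) (λ π → lossCount (pick π (range 0 m)) (pick π (range m (n ∸ m))) k)
      ≡⟨ sumOver-lossCount xs uxs k (range 0 m) (range m (n ∸ m)) split-positions ⟩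
    length (perms xs) * lossPaths (length (range 0 m)) (length (range m (n ∸ m))) k
      ≡⟨ cong₂ (λ a b → length (perms xs) * lossPaths a b k) (length-range 0 m) (length-range m (n ∸ m)) ⟩
    length (perms xs) * lossPaths m (n ∸ m) k ∎
    where
    open ≡-Reasoning
    n : ℕ
    n = length xs
    m≤π : ∀ {π} → π ∈ perms xs → m ≤ length π
    m≤π π∈ = subst (m ≤_) (sym (∈-perms⇒length xs uxs π∈)) m≤n
    take-pick : ∀ {π} → π ∈ perms xs → take m π ≡ pick π (range 0 m)
    take-pick {π} π∈ = take≡pick m π (m≤π π∈)
    drop-pick : ∀ {π} → π ∈ perms xs → drop m π ≡ pick π (range m (n ∸ m))
    drop-pick {π} π∈ = trans (drop≡pick m π (m≤π π∈)) (cong (λ t → pick π (range m (t ∸ m))) (∈-perms⇒length xs uxs π∈))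
    split-positions : Positions n (range 0 m ++ range m (n ∸ m))
    split-positions = subst (Positions n) (trans (cong (range 0) (sym (m+[n∸m]≡n m≤n))) (range-++ 0 m (n ∸ m)))
                            (range-unique 0 n , All.map proj₂ (range-bounds 0 n))


open import Defs
open import Data.Nat using (ℕ; suc; _+_; _*_; _∸_; _^_; _≤_; _%_; _/_)
open import Data.Nat.Base using (_!)
open import Data.Nat.Properties using (suc-injective; m≤m+n; ≤-trans; m+[n∸m]≡n; +-cancelˡ-≤; *-comm; *-assoc; _!≢0; m*n≢0; m^n≢0)
open import Data.List using (upTo; length)
open import Data.List.Properties using (length-map; length-applyUpTo)
open import Data.List.Relation.Unary.Unique.Propositional using (Unique)
open import Data.List.Relation.Unary.Unique.Propositional.Properties using (map⁺; upTo⁺)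
open import Relation.Binary.PropositionalEquality
open Fraction
open FirstPassage using (firstPassages; catalanTri≡firstPassages-halves)
open InsertionPermutations using (length-perms)
open Rounds using (lossPaths; lossPaths≡firstPassages)
open Deal using (sumOver-lossCount-take-drop)

cards-unique : ∀ n → Unique (cards n)
cards-unique n = map⁺ suc-injective (upTo⁺ n)

length-cards : ∀ n → length (cards n) ≡ n
length-cards n = trans (length-map suc (upTo n)) (length-applyUpTo (λ x → x) n)

favourable≡n!*firstPassages : ∀ n m R → m + R ≤ n → favourable n m R ≡ n ! * firstPassages m R
favourable≡n!*firstPassages n m R m+R≤n = begin
  favourable n m R
    ≡⟨ sumOver-lossCount-take-drop (cards n) (cards-unique n) m R (subst (m ≤_) (sym (length-cards n)) m≤n) ⟩
  length (perms (cards n)) * lossPaths m (length (cards n) ∸ m) R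
    ≡⟨ cong₂ (λ a b → a * lossPaths m (b ∸ m) R) (trans (length-perms (cards n)) (cong _! (length-cards n))) (length-cards n) ⟩
  n ! * lossPaths m (n ∸ m) R
    ≡⟨ cong (n ! *_) (lossPaths≡firstPassages m (n ∸ m) R R≤n∸m) ⟩
  n ! * firstPassages m R ∎
  where
  open ≡-Reasoning
  m≤n : m ≤ n
  m≤n = ≤-trans (m≤m+n m R) m+R≤n
  R≤n∸m : R ≤ n ∸ m
  R≤n∸m = +-cancelˡ-≤ m R (n ∸ m) (subst (m + R ≤_) (sym (m+[n∸m]≡n m≤n)) m+R≤n)

theorem5p2 : (n m R : ℕ) → 1 ≤ m → m ≤ R → R % 2 ≡ m % 2 → m + R ≤ n →
    probAliceLosesAfter n m R
      ≡ catalanTri ((R + m) / 2 ∸ 1) ((R ∸ m) / 2) /2^ R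
theorem5p2 n m R 1≤m m≤R parity m+R≤n =
  cross-mul⇒/≡/ (favourable n m R) c (n ! * 2 ^ R) (2 ^ R) {{m*n≢0 (n !) (2 ^ R) {{n !≢0}} {{m^n≢0 2 R}}}} {{m^n≢0 2 R}}
    (begin
      favourable n m R * 2 ^ R    ≡⟨ cong (_* 2 ^ R) (favourable≡n!*firstPassages n m R m+R≤n) ⟩
      n ! * firstPassages m R * 2 ^ R
        ≡⟨ cong (λ x → n ! * x * 2 ^ R) (sym (catalanTri≡firstPassages-halves m R 1≤m m≤R parity)) ⟩
      n ! * c * 2 ^ R             ≡⟨ cong (_* 2 ^ R) (*-comm (n !) c) ⟩
      c * n ! * 2 ^ R             ≡⟨ *-assoc c (n !) (2 ^ R) ⟩
      c * (n ! * 2 ^ R)           ∎)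
  where
  open ≡-Reasoning
  c : ℕ
  c = catalanTri ((R + m) / 2 ∸ 1) ((R ∸ m) / 2)
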